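{- The spectrum of an orbigraph does not distinguish good orbigraphs from bad orbigraphs: there exist a good connected orbigraph and a bad connected orbigraph whose adjacency matrices have the same multiset of eigenvalues.
   Context: A $k$-orbigraph is a finite weighted directed graph $\Omega$ (loops allowed) on vertices $v_1,\dots,v_n$ whose adjacency matrix $A$ ($A_{ij}$ = weight of the directed edge $(v_i,v_j)$, $0$ if absent) satisfies: $A_{ij}\in\mathbb{Z}_{\ge 0}$; $\sum_j A_{ij}=k$ for every $i$; and $A_{ij}>0$ iff $A_{ji}>0$. It is connected if its underlying graph is connected. An undirected edge $\{u,v\}$ of weight $w$ is identified with the pair of directed edges $(u,v)$, $(v,u)$ of weight $w$; a simple $k$-regular graph is regarded as a weighted directed graph with all weights $1$. For a weighted graph $\Gamma$ with weight function $w$, a partition $\mathcal{P}=\{V_1,\dots,V_m\}$ of its vertices is equitable if for all $i,j$ the quantity $\sum_{v\in V_j} w(u,v)$ is the same for all $u\in V_i$; the quotient $\Gamma/\mathcal{P}$ is the weighted directed graph with adjacency matrix entries $\sum_{v\in V_j} w(u,v)$, $u\in V_i$. A $k$-orbigraph is good if it is (up to isomorphism) $\Gamma/\mathcal{P}$ for some finite $k$-regular graph $\Gamma$ and equitable partition $\mathcal{P}$; otherwise it is bad. -}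

module Defs where

open import Data.Nat using (ℕ; zero; suc; _+_; _<_)
open import Data.Integer as ℤ using (ℤ)
open import Data.Fin using (Fin; zero; suc; punchIn; _≟_)
open import Data.Bool using (Bool; true; false; if_then_else_)
open import Data.List using (List; []; _∷_)
open import Data.Product using (Σ; ∃; _×_; _,_)
open import Relation.Binary.PropositionalEquality using (_≡_)
open import Relation.Nullary using (¬_; does)

sumFin : ∀ {n} → (Fin n → ℕ) → ℕ
sumFin {zero}  f = 0
sumFin {suc n} f = f zero + sumFin (λ i → f (suc i))

-- Weighted directed graphs on Fin n: adjacency matrix A i j = weight of (v_i , v_j)

Matrix : ℕ → Set
Matrix n = Fin n → Fin n → ℕ

record IsOrbigraph (k n : ℕ) (A : Matrix n) : Set where
  field
    rowSum   : ∀ i → sumFin (A i) ≡ k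
    symSupp  : ∀ i j → 0 < A i j → 0 < A j i

data Reachable {n : ℕ} (A : Matrix n) : Fin n → Fin n → Set where
  here : ∀ {i} → Reachable A i i
  step : ∀ {i j l} → 0 < A i j → Reachable A j l → Reachable A i l

Connected : ∀ {n} → Matrix n → Set
Connected {n} A = 0 < n × (∀ i j → Reachable A i j)

record SimpleGraph (N : ℕ) : Set where
  field
    adj     : Fin N → Fin N → Bool
    sym     : ∀ u v → adj u v ≡ adj v u
    irrefl  : ∀ u → adj u u ≡ false

open SimpleGraph public

weight : ∀ {N} → SimpleGraph N → Fin N → Fin N → ℕ
weight Γ u v = if adj Γ u v then 1 else 0

IsRegular : ∀ {N} → ℕ → SimpleGraph N → Set
IsRegular k Γ = ∀ u → sumFin (weight Γ u) ≡ k

-- Partitions of Fin N into m (nonempty) parts, given by a surjective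
-- part-assignment map π : Fin N → Fin m (part j = π⁻¹ j).

Surjective : ∀ {N m} → (Fin N → Fin m) → Set
Surjective {N} {m} π = ∀ (j : Fin m) → ∃ λ (u : Fin N) → π u ≡ j

blockSum : ∀ {N m} → SimpleGraph N → (Fin N → Fin m) → Fin N → Fin m → ℕ
blockSum Γ π u j = sumFin (λ v → if does (π v ≟ j) then weight Γ u v else 0)

IsEquitable : ∀ {N m} → SimpleGraph N → (Fin N → Fin m) → Set
IsEquitable Γ π = ∀ u u' j → π u ≡ π u' → blockSum Γ π u j ≡ blockSum Γ π u' j

-- Γ/P is isomorphic to the weighted digraph with matrix A (on Fin n):
-- a bijection σ : Fin n → Fin m (vertex i of A ↦ part σ i) such that
-- A i j equals the quotient entry Σ_{v ∈ V_{σ j}} w(u,v) for u ∈ V_{σ i}.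
record QuotientIso {N m n : ℕ} (Γ : SimpleGraph N) (π : Fin N → Fin m)
                   (A : Matrix n) : Set where
  field
    σ       : Fin n → Fin m
    σ⁻¹     : Fin m → Fin n
    σ⁻¹∘σ   : ∀ i → σ⁻¹ (σ i) ≡ i
    σ∘σ⁻¹   : ∀ j → σ (σ⁻¹ j) ≡ j
    entries : ∀ i j u → π u ≡ σ i → A i j ≡ blockSum Γ π u (σ j)

Good : (k : ℕ) {n : ℕ} → Matrix n → Set
Good k {n} A =
  Σ ℕ λ N → Σ (SimpleGraph N) λ Γ → IsRegular k Γ ×
  Σ ℕ λ m → Σ (Fin N → Fin m) λ π →
    Surjective π × IsEquitable Γ π × QuotientIso Γ π A

Bad : (k : ℕ) {n : ℕ} → Matrix n → Set
Bad k A = ¬ Good k A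

-- Polynomials over ℤ as coefficient lists (lowest degree first)

Poly : Set
Poly = List ℤ

_+ₚ_ : Poly → Poly → Poly
[]       +ₚ q        = q
(a ∷ p)  +ₚ []       = a ∷ p
(a ∷ p)  +ₚ (b ∷ q)  = (a ℤ.+ b) ∷ (p +ₚ q)

scaleₚ : ℤ → Poly → Poly
scaleₚ c []      = []
scaleₚ c (a ∷ p) = (c ℤ.* a) ∷ scaleₚ c p

_*ₚ_ : Poly → Poly → Poly
[]      *ₚ q = []
(a ∷ p) *ₚ q = scaleₚ a q +ₚ (ℤ.0ℤ ∷ (p *ₚ q))

negₚ : Poly → Poly
negₚ = scaleₚ (ℤ.- ℤ.1ℤ)

constₚ : ℤ → Poly
constₚ c = c ∷ []

Xₚ : Poly
Xₚ = ℤ.0ℤ ∷ ℤ.1ℤ ∷ []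

isZeroList : Poly → Bool
isZeroList []      = true
isZeroList (a ∷ p) = if does (a ℤ.≟ ℤ.0ℤ) then isZeroList p else false

normₚ : Poly → Poly
normₚ []      = []
normₚ (a ∷ p) = if isZeroList (a ∷ p) then [] else a ∷ normₚ p

_≈ₚ_ : Poly → Poly → Set
p ≈ₚ q = normₚ p ≡ normₚ q

sumPoly : ∀ {n} → (Fin n → Poly) → Poly
sumPoly {zero}  f = []
sumPoly {suc n} f = f zero +ₚ sumPoly (λ i → f (suc i))

det : ∀ {n} → (Fin n → Fin n → Poly) → Poly
det {zero}  M = constₚ ℤ.1ℤ
det {suc n} M = sumPoly (λ j → sign j (M zero j *ₚ det (λ a b → M (suc a) (punchIn j b))))
  where
  sign : ∀ {m} → Fin m → Poly → Poly
  sign zero          p = p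
  sign (suc zero)    p = negₚ p
  sign (suc (suc i)) p = sign i p

charPoly : ∀ {n} → Matrix n → Poly
charPoly {n} A = det (λ i j → (if does (i ≟ j) then Xₚ else []) +ₚ negₚ (constₚ (ℤ.+ A i j)))

-- same multiset of (complex) eigenvalues  ⇔  same characteristic polynomial
Cospectral : ∀ {n₁ n₂} → Matrix n₁ → Matrix n₂ → Set
Cospectral A B = charPoly A ≈ₚ charPoly B

-- The good orbigraph is 2(J − I) on three vertices, the quotient of the octahedron K₂,₂,₂
-- by its three pairs of antipodal vertices.  For the bad one, count the directed edges
-- between two parts Vᵢ, Vⱼ of an equitable partition in both directions: this gives
-- |Vᵢ| Aᵢⱼ = |Vⱼ| Aⱼᵢ, so every good orbigraph admits positive vertex weights in detailed
-- balance with its matrix.  The matrix with rows (0,2,2), (2,0,2), (1,3,0) does not, since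
-- it would force |V₀| = |V₁|, 2|V₁| = 3|V₂| and |V₂| = 2|V₀|.  Both matrices have
-- characteristic polynomial (x − 4)(x + 2)².
module Submission where

open import Defs hiding (sym)
open import Data.Bool using (Bool; true; false; not; if_then_else_)
open import Data.Fin using (Fin; zero; suc; _≟_; quotient; combine)
open import Data.Fin.Properties using (remQuot-combine)
import Data.Integer as ℤ
open import Data.Nat using (ℕ; zero; suc; _+_; _*_; _<_; _≤_; s≤s; z≤n; >-nonZero)
open import Data.Nat.Properties
  using (≤-trans; m≤m+n; m≤n+m; *-cancelˡ-≡; *-identityˡ; *-identityʳ; *-monoˡ-<; +-*-semiring)
open import Algebra.Properties.Semiring.Sum +-*-semiring using (sum; sum-cong-≗; ∑-comm; *-distribʳ-sum)
open import Function using (id; _∘_)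
open import Data.Product using (Σ; _×_; _,_; proj₁)
open import Relation.Nullary using (does; yes; no; ¬_; contradiction)
open import Relation.Binary.PropositionalEquality

-- Iverson bracket, the shape in which `weight` and `blockSum` are written.
infixr 8 [_]*_
[_]*_ : Bool → ℕ → ℕ
[ b ]* x = if b then x else 0

[]*-comm : ∀ b c x → [ b ]* [ c ]* x ≡ [ c ]* [ b ]* x
[]*-comm true  true  x = refl
[]*-comm true  false x = refl
[]*-comm false true  x = refl
[]*-comm false false x = refl

sumFin≡sum : ∀ {n} (f : Fin n → ℕ) → sumFin f ≡ sum f
sumFin≡sum {zero}  f = refl
sumFin≡sum {suc n} f = cong (f zero +_) (sumFin≡sum (λ i → f (suc i)))

sumFin-cong : ∀ {n} {f g : Fin n → ℕ} → (∀ i → f i ≡ g i) → sumFin f ≡ sumFin g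
sumFin-cong {f = f} {g} f≗g = begin
  sumFin f ≡⟨ sumFin≡sum f ⟩
  sum f    ≡⟨ sum-cong-≗ f≗g ⟩
  sum g    ≡⟨ sumFin≡sum g ⟨
  sumFin g ∎
  where open ≡-Reasoning

sumFin-comm : ∀ {m n} (f : Fin m → Fin n → ℕ) →
              sumFin (λ i → sumFin (f i)) ≡ sumFin (λ j → sumFin (λ i → f i j))
sumFin-comm f = begin
  sumFin (λ i → sumFin (f i))           ≡⟨ sumFin-cong (λ i → sumFin≡sum (f i)) ⟩
  sumFin (λ i → sum (f i))              ≡⟨ sumFin≡sum (λ i → sum (f i)) ⟩
  sum (λ i → sum (f i))                 ≡⟨ ∑-comm f ⟩
  sum (λ j → sum (λ i → f i j))         ≡⟨ sumFin≡sum (λ j → sum (λ i → f i j)) ⟨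
  sumFin (λ j → sum (λ i → f i j))      ≡⟨ sumFin-cong (λ j → sumFin≡sum (λ i → f i j)) ⟨
  sumFin (λ j → sumFin (λ i → f i j))   ∎
  where open ≡-Reasoning

sumFin-*ʳ : ∀ {n} (f : Fin n → ℕ) x → sumFin (λ i → f i * x) ≡ sumFin f * x
sumFin-*ʳ f x = begin
  sumFin (λ i → f i * x) ≡⟨ sumFin≡sum (λ i → f i * x) ⟩
  sum (λ i → f i * x)    ≡⟨ *-distribʳ-sum x f ⟨
  sum f * x              ≡⟨ cong (_* x) (sumFin≡sum f) ⟨
  sumFin f * x           ∎
  where open ≡-Reasoning

sumFin-[]* : ∀ {n} b (f : Fin n → ℕ) → sumFin (λ i → [ b ]* f i) ≡ [ b ]* sumFin f
sumFin-[]*     true  f = refl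
sumFin-[]* {n} false f = sumFin-zero {n}
  where
  sumFin-zero : ∀ {n} → sumFin {n} (λ _ → 0) ≡ 0
  sumFin-zero {zero}  = refl
  sumFin-zero {suc n} = sumFin-zero {n}

term≤sumFin : ∀ {n} (f : Fin n → ℕ) i → f i ≤ sumFin f
term≤sumFin f zero    = m≤m+n _ _
term≤sumFin f (suc i) = ≤-trans (term≤sumFin (λ k → f (suc k)) i) (m≤n+m _ (f zero))

Balanced : ∀ {n} → Matrix n → Set
Balanced {n} A = Σ (Fin n → ℕ) λ s → (∀ i → 0 < s i) × (∀ i j → s i * A i j ≡ s j * A j i)

module Partition {N m : ℕ} (π : Fin N → Fin m) where

  _∈ₚ_ : Fin N → Fin m → Bool
  u ∈ₚ a = does (π u ≟ a)

  partSize : Fin m → ℕ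
  partSize a = sumFin (λ u → [ u ∈ₚ a ]* 1)

  ∈ₚ-indicator : ∀ {u a} → π u ≡ a → [ u ∈ₚ a ]* 1 ≡ 1
  ∈ₚ-indicator {u} {a} πu≡a with π u ≟ a
  ... | yes _    = refl
  ... | no πu≢a  = contradiction πu≡a πu≢a

  partSize-pos : Surjective π → ∀ a → 0 < partSize a
  partSize-pos surj a with surj a
  ... | u , πu≡a = subst (_≤ partSize a) (∈ₚ-indicator πu≡a) (term≤sumFin _ u)

  module _ (Γ : SimpleGraph N) where

    crossEdges : Fin m → Fin m → ℕ
    crossEdges a b = sumFin (λ u → [ u ∈ₚ a ]* blockSum Γ π u b)

    crossEdges-sym : ∀ a b → crossEdges a b ≡ crossEdges b a
    crossEdges-sym a b = begin
      crossEdges a b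
        ≡⟨ sumFin-cong (λ u → sumFin-[]* (u ∈ₚ a) (λ v → [ v ∈ₚ b ]* weight Γ u v)) ⟨
      sumFin (λ u → sumFin (λ v → [ u ∈ₚ a ]* [ v ∈ₚ b ]* weight Γ u v))
        ≡⟨ sumFin-comm (λ u v → [ u ∈ₚ a ]* [ v ∈ₚ b ]* weight Γ u v) ⟩
      sumFin (λ v → sumFin (λ u → [ u ∈ₚ a ]* [ v ∈ₚ b ]* weight Γ u v))
        ≡⟨ sumFin-cong (λ v → sumFin-cong (λ u → swap u v)) ⟩
      sumFin (λ v → sumFin (λ u → [ v ∈ₚ b ]* [ u ∈ₚ a ]* weight Γ v u))
        ≡⟨ sumFin-cong (λ v → sumFin-[]* (v ∈ₚ b) (λ u → [ u ∈ₚ a ]* weight Γ v u)) ⟩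
      crossEdges b a ∎
      where
      open ≡-Reasoning
      swap : ∀ u v → [ u ∈ₚ a ]* [ v ∈ₚ b ]* weight Γ u v ≡ [ v ∈ₚ b ]* [ u ∈ₚ a ]* weight Γ v u
      swap u v rewrite SimpleGraph.sym Γ u v = []*-comm (u ∈ₚ a) (v ∈ₚ b) _

    module _ {n} {A : Matrix n} (I : QuotientIso Γ π A) where
      open QuotientIso I

      crossEdges-quotient : ∀ i j → crossEdges (σ i) (σ j) ≡ partSize (σ i) * A i j
      crossEdges-quotient i j = begin
        crossEdges (σ i) (σ j)                 ≡⟨ sumFin-cong entry ⟩
        sumFin (λ u → [ u ∈ₚ σ i ]* 1 * A i j) ≡⟨ sumFin-*ʳ (λ u → [ u ∈ₚ σ i ]* 1) (A i j) ⟩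
        partSize (σ i) * A i j                 ∎
        where
        open ≡-Reasoning
        entry : ∀ u → [ u ∈ₚ σ i ]* blockSum Γ π u (σ j) ≡ [ u ∈ₚ σ i ]* 1 * A i j
        entry u with π u ≟ σ i
        ... | yes πu≡σi = sym (trans (*-identityˡ (A i j)) (entries i j u πu≡σi))
        ... | no _      = refl

      quotient-balanced : Surjective π → Balanced A
      quotient-balanced surj = (λ i → partSize (σ i)) , (λ i → partSize-pos surj (σ i)) , balance
        where
        balance : ∀ i j → partSize (σ i) * A i j ≡ partSize (σ j) * A j i
        balance i j = begin
          partSize (σ i) * A i j    ≡⟨ crossEdges-quotient i j ⟨
          crossEdges (σ i) (σ j)    ≡⟨ crossEdges-sym (σ i) (σ j) ⟩
          crossEdges (σ j) (σ i)    ≡⟨ crossEdges-quotient j i ⟩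
          partSize (σ j) * A j i    ∎
          where open ≡-Reasoning

good⇒balanced : ∀ {k n} {A : Matrix n} → Good k A → Balanced A
good⇒balanced (_ , Γ , _ , _ , π , surj , _ , I) = Partition.quotient-balanced π Γ I surj

OffDiagonalPositive : ∀ {n} → Matrix n → Set
OffDiagonalPositive {n} A = ∀ (i j : Fin n) → i ≢ j → 0 < A i j

module _ {n} {A : Matrix n} (A⁺ : OffDiagonalPositive A) where

  offDiagonalPositive⇒symSupp : ∀ i j → 0 < A i j → 0 < A j i
  offDiagonalPositive⇒symSupp i j Aij>0 with i ≟ j
  ... | yes refl = Aij>0
  ... | no i≢j   = A⁺ j i (i≢j ∘ sym)

  offDiagonalPositive⇒reachable : ∀ i j → Reachable A i j
  offDiagonalPositive⇒reachable i j with i ≟ j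
  ... | yes refl = here
  ... | no i≢j   = step (A⁺ i j i≢j) here

  offDiagonalPositive⇒connected : 0 < n → Connected A
  offDiagonalPositive⇒connected n>0 = n>0 , offDiagonalPositive⇒reachable

scaledComplete : ∀ m → ℕ → Matrix m
scaledComplete m t i j = [ not (does (i ≟ j)) ]* t

scaledComplete-offDiagonalPositive : ∀ m t → OffDiagonalPositive (scaledComplete m (suc t))
scaledComplete-offDiagonalPositive m t i j i≢j with i ≟ j
... | yes i≡j = contradiction i≡j i≢j
... | no _    = s≤s z≤n

module _ {N m : ℕ} (π : Fin N → Fin m) where
  open Partition π using (_∈ₚ_; partSize)

  completeMultipartite : SimpleGraph N
  completeMultipartite = record
    { adj    = λ u v → not (does (π u ≟ π v))
    ; sym    = λ u v → cong not (≟-sym (π u) (π v))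
    ; irrefl = λ u → cong not (≟-refl (π u))
    }
    where
    ≟-sym : ∀ a b → does (a ≟ b) ≡ does (b ≟ a)
    ≟-sym a b with a ≟ b | b ≟ a
    ... | yes _   | yes _   = refl
    ... | yes a≡b | no b≢a  = contradiction (sym a≡b) b≢a
    ... | no a≢b  | yes b≡a = contradiction (sym b≡a) a≢b
    ... | no _    | no _    = refl
    ≟-refl : ∀ a → does (a ≟ a) ≡ true
    ≟-refl a with a ≟ a
    ... | yes _   = refl
    ... | no a≢a  = contradiction refl a≢a

  blockSum-completeMultipartite : ∀ u b →
    blockSum completeMultipartite π u b ≡ [ not (does (π u ≟ b)) ]* partSize b
  blockSum-completeMultipartite u b = begin
    sumFin (λ v → [ v ∈ₚ b ]* [ not (does (π u ≟ π v)) ]* 1)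
      ≡⟨ sumFin-cong moveIndicator ⟩
    sumFin (λ v → [ not (does (π u ≟ b)) ]* [ v ∈ₚ b ]* 1)
      ≡⟨ sumFin-[]* (not (does (π u ≟ b))) (λ v → [ v ∈ₚ b ]* 1) ⟩
    [ not (does (π u ≟ b)) ]* partSize b ∎
    where
    open ≡-Reasoning
    moveIndicator : ∀ v → [ v ∈ₚ b ]* [ not (does (π u ≟ π v)) ]* 1 ≡ [ not (does (π u ≟ b)) ]* [ v ∈ₚ b ]* 1
    moveIndicator v with π v ≟ b
    ... | yes refl = refl
    ... | no _     = sym ([]*-comm (not (does (π u ≟ b))) false 1)

  completeMultipartite-equitable : IsEquitable completeMultipartite π
  completeMultipartite-equitable u v b πu≡πv = begin
    blockSum completeMultipartite π u b  ≡⟨ blockSum-completeMultipartite u b ⟩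
    [ not (does (π u ≟ b)) ]* partSize b ≡⟨ cong (λ a → [ not (does (a ≟ b)) ]* partSize b) πu≡πv ⟩
    [ not (does (π v ≟ b)) ]* partSize b ≡⟨ blockSum-completeMultipartite v b ⟨
    blockSum completeMultipartite π v b  ∎
    where open ≡-Reasoning

  completeMultipartite-quotient : ∀ t → (∀ b → partSize b ≡ t) →
                                  QuotientIso completeMultipartite π (scaledComplete m t)
  completeMultipartite-quotient t |Vb|≡t = record
    { σ = id ; σ⁻¹ = id ; σ⁻¹∘σ = λ _ → refl ; σ∘σ⁻¹ = λ _ → refl
    ; entries = λ i j u πu≡i → sym (trans (blockSum-completeMultipartite u j)
                                          (cong₂ (λ a s → [ not (does (a ≟ j)) ]* s) πu≡i (|Vb|≡t j)))
    }

  completeMultipartite-good : ∀ k t → Surjective π → (∀ b → partSize b ≡ t) →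
                              IsRegular k completeMultipartite → Good k (scaledComplete m t)
  completeMultipartite-good k t surj |Vb|≡t regular =
    N , completeMultipartite , regular , m , π , surj ,
    completeMultipartite-equitable , completeMultipartite-quotient t |Vb|≡t

doubledTriangle : Matrix 3
doubledTriangle = scaledComplete 3 2

-- The antipodal pairs of the octahedron are {0,1}, {2,3}, {4,5}.
octahedronParts : Fin 6 → Fin 3
octahedronParts = quotient {3} 2

doubledTriangle-good : Good 4 doubledTriangle
doubledTriangle-good = completeMultipartite-good octahedronParts 4 2 surjective partSize≡2 regular
  where
  open Partition octahedronParts using (partSize)
  surjective : Surjective octahedronParts
  surjective a = combine {3} {2} a zero , cong proj₁ (remQuot-combine {3} {2} a zero)
  partSize≡2 : ∀ a → partSize a ≡ 2
  partSize≡2 zero             = refl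
  partSize≡2 (suc zero)       = refl
  partSize≡2 (suc (suc zero)) = refl
  regular : IsRegular 4 (completeMultipartite octahedronParts)
  regular zero                                = refl
  regular (suc zero)                          = refl
  regular (suc (suc zero))                    = refl
  regular (suc (suc (suc zero)))              = refl
  regular (suc (suc (suc (suc zero))))        = refl
  regular (suc (suc (suc (suc (suc zero))))) = refl

doubledTriangle-orbigraph : IsOrbigraph 4 3 doubledTriangle
doubledTriangle-orbigraph = record
  { rowSum  = λ { zero → refl ; (suc zero) → refl ; (suc (suc zero)) → refl }
  ; symSupp = offDiagonalPositive⇒symSupp (scaledComplete-offDiagonalPositive 3 1)
  }

skewTriangle : Matrix 3
skewTriangle zero             zero             = 0
skewTriangle zero             (suc zero)       = 2
skewTriangle zero             (suc (suc zero)) = 2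
skewTriangle (suc zero)       zero             = 2
skewTriangle (suc zero)       (suc zero)       = 0
skewTriangle (suc zero)       (suc (suc zero)) = 2
skewTriangle (suc (suc zero)) zero             = 1
skewTriangle (suc (suc zero)) (suc zero)       = 3
skewTriangle (suc (suc zero)) (suc (suc zero)) = 0

skewTriangle-offDiagonalPositive : OffDiagonalPositive skewTriangle
skewTriangle-offDiagonalPositive zero             zero             0≢0 = contradiction refl 0≢0
skewTriangle-offDiagonalPositive zero             (suc zero)       _   = s≤s z≤n
skewTriangle-offDiagonalPositive zero             (suc (suc zero)) _   = s≤s z≤n
skewTriangle-offDiagonalPositive (suc zero)       zero             _   = s≤s z≤n
skewTriangle-offDiagonalPositive (suc zero)       (suc zero)       1≢1 = contradiction refl 1≢1
skewTriangle-offDiagonalPositive (suc zero)       (suc (suc zero)) _   = s≤s z≤n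
skewTriangle-offDiagonalPositive (suc (suc zero)) zero             _   = s≤s z≤n
skewTriangle-offDiagonalPositive (suc (suc zero)) (suc zero)       _   = s≤s z≤n
skewTriangle-offDiagonalPositive (suc (suc zero)) (suc (suc zero)) 2≢2 = contradiction refl 2≢2

skewTriangle-orbigraph : IsOrbigraph 4 3 skewTriangle
skewTriangle-orbigraph = record
  { rowSum  = λ { zero → refl ; (suc zero) → refl ; (suc (suc zero)) → refl }
  ; symSupp = offDiagonalPositive⇒symSupp skewTriangle-offDiagonalPositive
  }

skewTriangle-unbalanced : ¬ Balanced skewTriangle
skewTriangle-unbalanced (s , s>0 , balance) = contradiction (*-cancelˡ-≡ 1 3 x x≡x*3) λ ()
  where
  open ≡-Reasoning
  x = s zero * 2
  instance _ = >-nonZero (*-monoˡ-< 2 (s>0 zero))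
  x≡x*3 : x * 1 ≡ x * 3
  x≡x*3 = begin
    x * 1                      ≡⟨ *-identityʳ x ⟩
    s zero * 2                 ≡⟨ balance zero (suc zero) ⟩
    s (suc zero) * 2           ≡⟨ balance (suc zero) (suc (suc zero)) ⟩
    s (suc (suc zero)) * 3     ≡⟨ cong (_* 3) (*-identityʳ (s (suc (suc zero)))) ⟨
    s (suc (suc zero)) * 1 * 3 ≡⟨ cong (_* 3) (balance (suc (suc zero)) zero) ⟩
    x * 3                      ∎

skewTriangle-bad : Bad 4 skewTriangle
skewTriangle-bad = skewTriangle-unbalanced ∘ good⇒balanced

characteristicPolynomial : Poly
characteristicPolynomial = (Xₚ +ₚ constₚ (ℤ.- ℤ.+ 4)) *ₚ ((Xₚ +ₚ constₚ (ℤ.+ 2)) *ₚ (Xₚ +ₚ constₚ (ℤ.+ 2)))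

cospectral : Cospectral doubledTriangle skewTriangle
cospectral = trans charPoly-doubledTriangle (sym charPoly-skewTriangle)
  where
  charPoly-doubledTriangle : charPoly doubledTriangle ≈ₚ characteristicPolynomial
  charPoly-doubledTriangle = refl
  charPoly-skewTriangle : charPoly skewTriangle ≈ₚ characteristicPolynomial
  charPoly-skewTriangle = refl

theorem6p4 : Σ ℕ λ k₁ → Σ ℕ λ n₁ → Σ (Matrix n₁) λ A₁ →
             Σ ℕ λ k₂ → Σ ℕ λ n₂ → Σ (Matrix n₂) λ A₂ →
               (IsOrbigraph k₁ n₁ A₁ × Connected A₁ × Good k₁ A₁) ×
               (IsOrbigraph k₂ n₂ A₂ × Connected A₂ × Bad k₂ A₂) ×
               Cospectral A₁ A₂
theorem6p4 =
  4 , 3 , doubledTriangle , 4 , 3 , skewTriangle ,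
  ( doubledTriangle-orbigraph
  , offDiagonalPositive⇒connected (scaledComplete-offDiagonalPositive 3 1) (s≤s z≤n)
  , doubledTriangle-good ) ,
  ( skewTriangle-orbigraph
  , offDiagonalPositive⇒connected skewTriangle-offDiagonalPositive (s≤s z≤n)
  , skewTriangle-bad ) ,
  cospectral
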